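{- Let $c$ be a sorted stable configuration on $K_{m,n}$. If there is a nonempty $A\subseteq\{v_1,\dots,v_{n+m-1}\}$ with $c-\Delta_A$ stable, then the $\prec$-minimal such set $A$ (the one defining $\varphi(c)=c-\Delta_A$) is of the form $$A=\{v_{n-k},\dots,v_n\}\cup\{v_{m+n-1-l},\dots,v_{n+m-1}\}$$ for some $0\le k\le n-1$ and $0\le l\le m-2$. In this case $c_{n-k-1}<c_{n-k}$ whenever $k<n-1$, and $c_{m+n-2-l}<c_{m+n-1-l}$ whenever $l<m-2$.
   Context: $K_{m,n}$ has vertices $v_1,\dots,v_{n+m}$, a single edge between $v_i,v_j$ exactly when $i\le n<j$, sink $v_{n+m}$. Configurations are $c=(c_1,\dots,c_{n+m-1})\in\mathbb{Z}^{n+m-1}$. $\Delta_i$ is the toppling vector of $v_i$: for $i\le n$ it has entry $m$ at $i$ and $-1$ at $n+1,\dots,n+m-1$; for $n<i<n+m$ it has $n$ at $i$ and $-1$ at $1,\dots,n$; $\Delta_A=\sum_{v_i\in A}\Delta_i$. $c$ is stable if $0\le c_i\le m-1$ for $i\le n$ and $0\le c_i\le n-1$ for $n<i<n+m$; sorted if $c_1\le\dots\le c_n$ and $c_{n+1}\le\dots\le c_{n+m-1}$. Subsets of $\{v_1,\dots,v_{n+m-1}\}$ are ordered by $A\prec B$ if $|A|<|B|$, or $|A|=|B|$ and $A$ is lexicographically smaller than $B$ (increasing index listing). $\varphi(c)=c-\Delta_A$ for the $\prec$-minimal nonempty $A$ such that $c-\Delta_A$ is stable, if such $A$ exists, and $\varphi(c)=c$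 otherwise. -}

module Defs where

open import Data.Nat as ℕ using (ℕ; _∸_)
open import Data.Integer as ℤ using (ℤ; +_; _-_)
open import Data.Fin using (Fin; toℕ; zero; suc)
open import Data.Fin.Subset using (Subset; _∈_; ∣_∣; Nonempty; inside; outside)
open import Data.Vec using (Vec; []; _∷_)
open import Data.List using (List; []; _∷_; map)
open import Data.Bool using (Bool; true; false; if_then_else_)
open import Data.Product using (_×_)
open import Data.Sum using (_⊎_)
open import Relation.Nullary.Decidable using (⌊_⌋)
open import Relation.Binary.PropositionalEquality using (_≡_)

-- Non-sink vertices v_1 … v_{n+m-1} are represented by Fin (n + m ∸ 1);
-- the index i : Fin N stands for the vertex v_{toℕ i + 1}.
-- v_{j} (1-based) lies on the first side iff j ≤ n, i.e. toℕ i < n.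

Config : ℕ → ℕ → Set
Config n m = Fin (n ℕ.+ m ∸ 1) → ℤ

isLeft : (n : ℕ) → {N : ℕ} → Fin N → Bool
isLeft n i = ⌊ toℕ i ℕ.<? n ⌋

Δ : (n m : ℕ) → Fin (n ℕ.+ m ∸ 1) → Fin (n ℕ.+ m ∸ 1) → ℤ
Δ n m i j with isLeft n i | isLeft n j | ⌊ toℕ i ℕ.≟ toℕ j ⌋
... | true  | _     | true  = + m
... | true  | false | false = ℤ.- (+ 1)
... | true  | true  | false = + 0
... | false | _     | true  = + n
... | false | true  | false = ℤ.- (+ 1)
... | false | false | false = + 0

sumFin : (N : ℕ) → (Fin N → ℤ) → ℤ
sumFin ℕ.zero    f = + 0
sumFin (ℕ.suc N) f = f zero ℤ.+ sumFin N (λ i → f (suc i))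

ΔSet : (n m : ℕ) → Subset (n ℕ.+ m ∸ 1) → Fin (n ℕ.+ m ∸ 1) → ℤ
ΔSet n m A j = sumFin (n ℕ.+ m ∸ 1) (λ i → indicator i)
  where
  open import Data.Vec using (lookup)
  indicator : Fin (n ℕ.+ m ∸ 1) → ℤ
  indicator i with lookup A i
  ... | true  = Δ n m i j
  ... | false = + 0

topple : (n m : ℕ) → Config n m → Subset (n ℕ.+ m ∸ 1) → Config n m
topple n m c A j = c j - ΔSet n m A j

Stable : (n m : ℕ) → Config n m → Set
Stable n m c = ∀ j → (+ 0 ℤ.≤ c j) ×
  (if isLeft n j then c j ℤ.≤ + m - + 1 else c j ℤ.≤ + n - + 1)

Sorted : (n m : ℕ) → Config n m → Set
Sorted n m c = ∀ (i j : Fin (n ℕ.+ m ∸ 1)) → toℕ j ≡ ℕ.suc (toℕ i) →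
  (toℕ j ℕ.< n ⊎ n ℕ.≤ toℕ i) → c i ℤ.≤ c j

elems : {N : ℕ} → Subset N → List ℕ
elems []            = []
elems (true  ∷ p)   = 0 ∷ map ℕ.suc (elems p)
elems (false ∷ p)   = map ℕ.suc (elems p)

data LexLt : List ℕ → List ℕ → Set where
  nil<cons : ∀ {y ys} → LexLt [] (y ∷ ys)
  here     : ∀ {x y xs ys} → x ℕ.< y → LexLt (x ∷ xs) (y ∷ ys)
  there    : ∀ {x xs ys} → LexLt xs ys → LexLt (x ∷ xs) (x ∷ ys)

_≺_ : {N : ℕ} → Subset N → Subset N → Set
A ≺ B = (∣ A ∣ ℕ.< ∣ B ∣) ⊎ ((∣ A ∣ ≡ ∣ B ∣) × LexLt (elems A) (elems B))

Admissible : (n m : ℕ) → Config n m → Subset (n ℕ.+ m ∸ 1) → Set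
Admissible n m c A = Nonempty A × Stable n m (topple n m c A)

MinimalAdmissible : (n m : ℕ) → Config n m → Subset (n ℕ.+ m ∸ 1) → Set
MinimalAdmissible n m c A =
  Admissible n m c A × (∀ B → Admissible n m c B → (B ≺ A → Data.Empty.⊥))
  where import Data.Empty

-- Firing the vertices of A changes coordinate j by −deg(v_j)·[j ∈ A] plus the number of
-- vertices of A on the other side, a quantity that depends only on the side of v_j.  Hence
-- c − Δ_A is stable exactly when, on each side, A consists of the vertices with
-- deg(v_j) ≤ c_j + (that number): a threshold set, which for sorted c is a final segment of
-- the side, and c increases strictly where the segment starts.  Neither segment is empty,
-- since a vertex of A can only fire if it receives a chip from A on the other side.
module Submission where

open import Defs
open import Data.Nat using (ℕ; suc; _+_; _∸_; _≤_)
open import Data.Integer using (_<_)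
open import Data.Fin using (Fin; toℕ)
open import Data.Fin.Subset using (Subset; _∈_)
open import Data.Product using (Σ; _×_)
open import Data.Sum using (_⊎_)
open import Relation.Binary.PropositionalEquality using (_≡_)

open import Data.Bool using (Bool; true; false; T; not; _∧_; _xor_; if_then_else_)
open import Data.Bool.Properties using (T-∧; T-≡; T-not-≡)
open import Data.Fin using (zero; suc; fromℕ<)
open import Data.Fin.Properties using (suc-injective; toℕ-injective; toℕ-fromℕ<; toℕ<n)
open import Data.Fin.Subset using (_∉_; Nonempty)
open import Data.Fin.Subset.Properties using (_∈?_)
open import Data.Integer as ℤ using (ℤ; +_; 0ℤ; -1ℤ; _-_)
import Data.Integer.Properties as ℤ
open import Data.Integer.Tactic.RingSolver using (solve-∀)
open import Data.Nat.Tactic.RingSolver using () renaming (solve-∀ to ℕ-solve-∀)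
import Data.Nat as ℕ
import Data.Nat.Properties as ℕ
open import Data.Product using (∃; _,_; proj₁; proj₂)
import Data.Product as Prod
open import Data.Sum using (inj₁; inj₂; [_,_]; map; map₁; map₂)
open import Data.Vec using (lookup)
open import Data.Vec.Properties using ([]=⇒lookup; lookup⇒[]=)
open import Function using (_∘_; const; id)
open import Function.Bundles using (_⇔_; mk⇔; Equivalence)
open import Relation.Binary.PropositionalEquality
  using (_≢_; refl; sym; trans; cong; cong₂; subst; module ≡-Reasoning)
open import Relation.Nullary using (yes; no; contradiction)
open import Relation.Nullary.Decidable
  using (⌊_⌋; _⊎-dec_; _×-dec_; isYes≗does; dec-true; dec-false; toWitness; toWitnessFalse)
open import Relation.Unary using (Pred; Decidable)

open Equivalence using (to; from)

sumFin-cong : ∀ N {f g : Fin N → ℤ} → (∀ i → f i ≡ g i) → sumFin N f ≡ sumFin N g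
sumFin-cong ℕ.zero    f≗g = refl
sumFin-cong (ℕ.suc N) f≗g = cong₂ ℤ._+_ (f≗g zero) (sumFin-cong N (f≗g ∘ suc))

sumFin-zero : ∀ N → sumFin N (const 0ℤ) ≡ 0ℤ
sumFin-zero ℕ.zero    = refl
sumFin-zero (ℕ.suc N) = trans (ℤ.+-identityˡ _) (sumFin-zero N)

sumFin-- : ∀ N (f g : Fin N → ℤ) → sumFin N (λ i → f i - g i) ≡ sumFin N f - sumFin N g
sumFin-- ℕ.zero    f g = refl
sumFin-- (ℕ.suc N) f g =
  trans (cong (ℤ._+_ (f zero - g zero)) (sumFin-- N (f ∘ suc) (g ∘ suc)))
        (interchange (f zero) (g zero) _ _)
  where
  interchange : ∀ a b c d → (a - b) ℤ.+ (c - d) ≡ (a ℤ.+ c) - (b ℤ.+ d)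
  interchange = solve-∀

sumFin-single : ∀ N (j : Fin N) (f : Fin N → ℤ) → (∀ i → i ≢ j → f i ≡ 0ℤ) → sumFin N f ≡ f j
sumFin-single (ℕ.suc N) zero    f vanish = begin
  f zero ℤ.+ sumFin N (f ∘ suc)  ≡⟨ cong (ℤ._+_ (f zero)) (sumFin-cong N (λ i → vanish (suc i) λ ())) ⟩
  f zero ℤ.+ sumFin N (const 0ℤ) ≡⟨ cong (ℤ._+_ (f zero)) (sumFin-zero N) ⟩
  f zero ℤ.+ 0ℤ                  ≡⟨ ℤ.+-identityʳ (f zero) ⟩
  f zero                         ∎
  where open ≡-Reasoning
sumFin-single (ℕ.suc N) (suc j) f vanish = begin
  f zero ℤ.+ sumFin N (f ∘ suc) ≡⟨ cong (ℤ._+ sumFin N (f ∘ suc)) (vanish zero λ ()) ⟩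
  0ℤ ℤ.+ sumFin N (f ∘ suc)     ≡⟨ ℤ.+-identityˡ _ ⟩
  sumFin N (f ∘ suc)            ≡⟨ sumFin-single N j (f ∘ suc) vanish-suc ⟩
  f (suc j)                     ∎
  where
  open ≡-Reasoning
  vanish-suc : ∀ i → i ≢ j → f (suc i) ≡ 0ℤ
  vanish-suc i i≢j = vanish (suc i) (i≢j ∘ suc-injective)

0<sumFin-indicator⇒∃ : ∀ N (P : Fin N → Bool) →
  0ℤ < sumFin N (λ i → if P i then + 1 else 0ℤ) → ∃ λ i → T (P i)
0<sumFin-indicator⇒∃ ℕ.zero    P (ℤ.+<+ ())
0<sumFin-indicator⇒∃ (ℕ.suc N) P pos with P zero in P0
... | true  = zero , subst T (sym P0) _
... | false with i , Pi ← 0<sumFin-indicator⇒∃ N (P ∘ suc) (subst (0ℤ <_) (ℤ.+-identityˡ _) pos) =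
  suc i , Pi

∉⇒lookup≡false : ∀ {N} {A : Subset N} {j} → j ∉ A → lookup A j ≡ false
∉⇒lookup≡false {A = A} {j} j∉A with lookup A j in A[j]
... | true  = contradiction (lookup⇒[]= j A A[j]) j∉A
... | false = refl

m∸[1+n]+1≤m : ∀ {m n} → n ℕ.< m → m ∸ suc n + 1 ≤ m
m∸[1+n]+1≤m {m} {n} n<m =
  ℕ.≤-trans (ℕ.+-monoʳ-≤ (m ∸ suc n) (ℕ.s≤s ℕ.z≤n)) (ℕ.≤-reflexive (ℕ.m∸n+n≡m n<m))

[n+m∸1]∸[1+t]+2≤m : ∀ {n m t} → n ≤ t → t ℕ.< n + m ∸ 1 → n + m ∸ 1 ∸ suc t + 2 ≤ m
[n+m∸1]∸[1+t]+2≤m {n} {m} {t} n≤t t<N = ℕ.+-cancelˡ-≤ n _ _ (begin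
  n + (l + 2)       ≤⟨ ℕ.+-monoˡ-≤ (l + 2) n≤t ⟩
  t + (l + 2)       ≡⟨ rearrange t l ⟩
  (l + suc t) + 1   ≡⟨ cong (_+ 1) (ℕ.m∸n+n≡m t<N) ⟩
  n + m ∸ 1 + 1     ≡⟨ ℕ.m∸n+n≡m 1≤n+m ⟩
  n + m             ∎)
  where
  open ℕ.≤-Reasoning
  1≤n+m : 1 ≤ n + m
  1≤n+m = ℕ.≤-trans (ℕ.s≤s ℕ.z≤n) (ℕ.≤-trans t<N (ℕ.m∸n≤m (n + m) 1))
  l : ℕ
  l = n + m ∸ 1 ∸ suc t
  rearrange : ∀ t l → t + (l + 2) ≡ (l + suc t) + 1
  rearrange = ℕ-solve-∀

[n+m∸1]∸[1+n]≡m∸2 : ∀ n m → n + m ∸ 1 ∸ suc n ≡ m ∸ 2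
[n+m∸1]∸[1+n]≡m∸2 n m = begin
  n + m ∸ 1 ∸ suc n   ≡⟨ ℕ.∸-+-assoc (n + m) 1 (suc n) ⟩
  n + m ∸ (2 + n)     ≡⟨ cong (n + m ∸_) (ℕ.+-comm 2 n) ⟩
  n + m ∸ (n + 2)     ≡⟨ ℕ.[m+n]∸[m+o]≡n∸o n m 2 ⟩
  m ∸ 2               ∎
  where open ≡-Reasoning

suc[[n+m∸1]∸[1+t]]≤m∸2⇒n<t : ∀ {n m t} → n ≤ t → suc (n + m ∸ 1 ∸ suc t) ≤ m ∸ 2 →
  n ℕ.< t
suc[[n+m∸1]∸[1+t]]≤m∸2⇒n<t {n} {m} n≤t 1+l≤m∸2 = ℕ.≤∧≢⇒< n≤t λ where
  refl → ℕ.n≮n (m ∸ 2) (subst (λ x → suc x ≤ m ∸ 2) ([n+m∸1]∸[1+n]≡m∸2 n m) 1+l≤m∸2)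

m∸2∸n≡pred[m∸1∸n] : ∀ m n → m ∸ 2 ∸ n ≡ ℕ.pred (m ∸ 1 ∸ n)
m∸2∸n≡pred[m∸1∸n] m n = begin
  m ∸ 2 ∸ n            ≡⟨ ℕ.∸-+-assoc m 2 n ⟩
  m ∸ suc (suc n)      ≡⟨ sym (ℕ.pred[m∸n]≡m∸[1+n] m (suc n)) ⟩
  ℕ.pred (m ∸ suc n)   ≡⟨ cong ℕ.pred (sym (ℕ.∸-+-assoc m 1 n)) ⟩
  ℕ.pred (m ∸ 1 ∸ n)   ∎
  where open ≡-Reasoning

module _ (n : ℕ) {K : ℕ} {j : Fin K} where

  isLeft-< : toℕ j ℕ.< n → isLeft n j ≡ true
  isLeft-< j<n = trans (isYes≗does (toℕ j ℕ.<? n)) (dec-true (toℕ j ℕ.<? n) j<n)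

  isLeft-≥ : n ≤ toℕ j → isLeft n j ≡ false
  isLeft-≥ n≤j =
    trans (isYes≗does (toℕ j ℕ.<? n)) (dec-false (toℕ j ℕ.<? n) (ℕ.≤⇒≯ n≤j))

  isLeft≡true⇒< : isLeft n j ≡ true → toℕ j ℕ.< n
  isLeft≡true⇒< = toWitness ∘ from T-≡

  isLeft≡false⇒≥ : isLeft n j ≡ false → n ≤ toℕ j
  isLeft≡false⇒≥ = ℕ.≮⇒≥ ∘ toWitnessFalse ∘ from T-not-≡

T-xor : ∀ a b → T (a xor b) → a ≡ not b
T-xor true  false _ = refl
T-xor false true  _ = refl

upward-closed⇒threshold : ∀ {N ℓ} {P : Pred (Fin N) ℓ} → Decidable P →
  (∀ {i j} → toℕ i ≤ toℕ j → P i → P j) → ∃ λ s → ∀ j → P j ⇔ s ≤ toℕ j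
upward-closed⇒threshold {ℕ.zero}  P? up = 0 , λ ()
upward-closed⇒threshold {ℕ.suc N} P? up with P? zero
... | yes P0 = 0 , λ j → mk⇔ (const ℕ.z≤n) (λ _ → up ℕ.z≤n P0)
... | no ¬P0 with s , P⇔ ← upward-closed⇒threshold (P? ∘ suc) (up ∘ ℕ.s≤s) =
  suc s , λ where
  zero    → mk⇔ (λ P0 → contradiction P0 ¬P0) (λ ())
  (suc j) → mk⇔ (ℕ.s≤s ∘ to (P⇔ j)) (from (P⇔ j) ∘ ℕ.s≤s⁻¹)

module _ (n m : ℕ) where

  private
    N : ℕ
    N = n + m ∸ 1

  degree : Bool → ℤ
  degree true  = + m
  degree false = + n

  neighboursIn : Subset N → Bool → ℤ
  neighboursIn A side =
    sumFin N (λ i → if lookup A i ∧ (isLeft n i xor side) then + 1 else 0ℤ)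

  Δ-pointwise : ∀ i j → Δ n m i j ≡
      (if ⌊ toℕ i ℕ.≟ toℕ j ⌋ then degree (isLeft n j) else 0ℤ)
    - (if isLeft n i xor isLeft n j then + 1 else 0ℤ)
  Δ-pointwise i j with toℕ i ℕ.≟ toℕ j
  ... | no _ with isLeft n i | isLeft n j
  ...   | true  | true  = refl
  ...   | true  | false = refl
  ...   | false | true  = refl
  ...   | false | false = refl
  Δ-pointwise i j | yes i≡j with refl ← toℕ-injective i≡j with isLeft n i
  ...   | true  = sym (ℤ.+-identityʳ (+ m))
  ...   | false = sym (ℤ.+-identityʳ (+ n))

  -- The summand of ΔSet is a with-function local to Defs; it is named here as the solution
  -- of a unification problem, so that `with` on `lookup A i` can see through it.
  private
    ΔSet-summand : (A : Subset N) (j : Fin N) → Σ (Fin N → ℤ) λ f → ΔSet n m A j ≡ sumFin N f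
    ΔSet-summand A j = _ , refl

    summand-pointwise : ∀ A j i → proj₁ (ΔSet-summand A j) i ≡
      (if ⌊ toℕ i ℕ.≟ toℕ j ⌋ then (if lookup A i then degree (isLeft n j) else 0ℤ) else 0ℤ)
      - (if lookup A i ∧ (isLeft n i xor isLeft n j) then + 1 else 0ℤ)
    summand-pointwise A j i with lookup A i
    ... | true = Δ-pointwise i j
    ... | false with toℕ i ℕ.≟ toℕ j
    ...   | yes _ = refl
    ...   | no  _ = refl

  ΔSet≡ : ∀ A j →
    ΔSet n m A j ≡ (if lookup A j then degree (isLeft n j) else 0ℤ) - neighboursIn A (isLeft n j)
  ΔSet≡ A j = begin
    ΔSet n m A j                           ≡⟨ proj₂ (ΔSet-summand A j) ⟩
    sumFin N (proj₁ (ΔSet-summand A j))    ≡⟨ sumFin-cong N (summand-pointwise A j) ⟩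
    sumFin N (λ i → self i - neighbour i) ≡⟨ sumFin-- N self neighbour ⟩
    sumFin N self - neighbours             ≡⟨ cong (_- neighbours) (sumFin-single N j self off-diagonal) ⟩
    self j - neighbours                    ≡⟨ cong (_- neighbours) diagonal ⟩
    (if lookup A j then degree (isLeft n j) else 0ℤ) - neighbours ∎
    where
    open ≡-Reasoning
    neighbours : ℤ
    neighbours = neighboursIn A (isLeft n j)
    self neighbour : Fin N → ℤ
    self i = if ⌊ toℕ i ℕ.≟ toℕ j ⌋ then (if lookup A i then degree (isLeft n j) else 0ℤ) else 0ℤ
    neighbour i = if lookup A i ∧ (isLeft n i xor isLeft n j) then + 1 else 0ℤ
    off-diagonal : ∀ i → i ≢ j → self i ≡ 0ℤ
    off-diagonal i i≢j with toℕ i ℕ.≟ toℕ j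
    ... | yes i≡j = contradiction (toℕ-injective i≡j) i≢j
    ... | no  _   = refl
    diagonal : self j ≡ (if lookup A j then degree (isLeft n j) else 0ℤ)
    diagonal with toℕ j ℕ.≟ toℕ j
    ... | yes _   = refl
    ... | no  j≢j = contradiction refl j≢j

  topple≡ : ∀ c A j → topple n m c A j ≡
    (c j ℤ.+ neighboursIn A (isLeft n j)) - (if lookup A j then degree (isLeft n j) else 0ℤ)
  topple≡ c A j = trans (cong (c j -_) (ΔSet≡ A j)) (rearrange (c j) _ _)
    where
    rearrange : ∀ x d b → x - (d - b) ≡ (x ℤ.+ b) - d
    rearrange = solve-∀

  stable⇒<degree : ∀ {c} → Stable n m c → ∀ j → c j < degree (isLeft n j)
  stable⇒<degree {c} stable j =
    ℤ.i≤pred[j]⇒i<j (subst (c j ℤ.≤_) (ℤ.+-comm (degree (isLeft n j)) -1ℤ) ≤degree-1)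
    where
    ≤degree-1 : c j ℤ.≤ degree (isLeft n j) - + 1
    ≤degree-1 with isLeft n j | proj₂ (stable j)
    ... | true  | c≤m-1 = c≤m-1
    ... | false | c≤n-1 = c≤n-1

  same-side : ∀ {i j : Fin N} → toℕ i ≤ toℕ j → toℕ j ℕ.< n ⊎ n ≤ toℕ i →
    isLeft n i ≡ isLeft n j
  same-side i≤j (inj₁ j<n) = trans (isLeft-< n (ℕ.≤-<-trans i≤j j<n)) (sym (isLeft-< n j<n))
  same-side i≤j (inj₂ n≤i) = trans (isLeft-≥ n n≤i) (sym (isLeft-≥ n (ℕ.≤-trans n≤i i≤j)))

  sorted-monotone : ∀ {c} → Sorted n m c →
    ∀ {i j} → toℕ i ≤ toℕ j → toℕ j ℕ.< n ⊎ n ≤ toℕ i → c i ℤ.≤ c j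
  sorted-monotone {c} sorted {i} {j} i≤j = go (toℕ j ∸ toℕ i) (sym (ℕ.m∸n+n≡m i≤j))
    where
    go : ∀ d {i j} → toℕ j ≡ d + toℕ i → toℕ j ℕ.< n ⊎ n ≤ toℕ i → c i ℤ.≤ c j
    go ℕ.zero    j≡i _ = ℤ.≤-reflexive (cong c (toℕ-injective (sym j≡i)))
    go (suc d) {i} {j} j≡1+d+i side =
      ℤ.≤-trans (go d k≡d+i (map₁ (ℕ.<-trans k<j) side))
                (sorted k j j≡1+k (map₂ (λ n≤i → ℕ.≤-trans n≤i i≤k) side))
      where
      k<N : d + toℕ i ℕ.< N
      k<N = ℕ.<-trans (ℕ.≤-reflexive (sym j≡1+d+i)) (toℕ<n j)
      k = fromℕ< k<N
      k≡d+i : toℕ k ≡ d + toℕ i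
      k≡d+i = toℕ-fromℕ< k<N
      j≡1+k : toℕ j ≡ suc (toℕ k)
      j≡1+k = trans j≡1+d+i (cong suc (sym k≡d+i))
      k<j : toℕ k ℕ.< toℕ j
      k<j = ℕ.≤-reflexive (sym j≡1+k)
      i≤k : toℕ i ≤ toℕ k
      i≤k = subst (toℕ i ≤_) (sym k≡d+i) (ℕ.m≤n+m (toℕ i) d)

  -- A = {v_{s+1}, …, v_n} ∪ {v_{t+1}, …, v_{n+m-1}}, with s and t as 0-based indices.
  record FinalSegments (A : Subset N) : Set where
    field
      s t   : ℕ
      s<n   : s ℕ.< n
      n≤t   : n ≤ t
      t<N   : t ℕ.< N
      ∈A⇔ : ∀ j → j ∈ A ⇔ ((s ≤ toℕ j × toℕ j ℕ.< n) ⊎ t ≤ toℕ j)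

  ∈A⇔-1-based : ∀ {A} (segments : FinalSegments A) → let open FinalSegments segments in
    ∀ {a b} → a ≡ suc s → b ≡ suc t → ∀ j →
    j ∈ A ⇔ ((a ≤ suc (toℕ j) × suc (toℕ j) ≤ n) ⊎ (b ≤ suc (toℕ j) × suc (toℕ j) ≤ N))
  ∈A⇔-1-based segments refl refl j = mk⇔
    (map (Prod.map₁ ℕ.s≤s) (λ t≤j → ℕ.s≤s t≤j , toℕ<n j) ∘ to (∈A⇔ j))
    (from (∈A⇔ j) ∘ map (Prod.map₁ ℕ.s≤s⁻¹) (ℕ.s≤s⁻¹ ∘ proj₁))
    where open FinalSegments segments

  module _ {c : Config n m} {A : Subset N} (stable-after : Stable n m (topple n m c A)) where

    ∈⇒degree≤ : ∀ {j} → j ∈ A →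
      degree (isLeft n j) ℤ.≤ c j ℤ.+ neighboursIn A (isLeft n j)
    ∈⇒degree≤ {j} j∈A = ℤ.0≤i-j⇒j≤i (subst (0ℤ ℤ.≤_) topple-j (proj₁ (stable-after j)))
      where
      topple-j : topple n m c A j ≡ (c j ℤ.+ neighboursIn A (isLeft n j)) - degree (isLeft n j)
      topple-j rewrite topple≡ c A j | []=⇒lookup j∈A = refl

    ∉⇒<degree : ∀ {j} → j ∉ A →
      c j ℤ.+ neighboursIn A (isLeft n j) < degree (isLeft n j)
    ∉⇒<degree {j} j∉A = subst (_< degree (isLeft n j)) topple-j (stable⇒<degree stable-after j)
      where
      topple-j : topple n m c A j ≡ c j ℤ.+ neighboursIn A (isLeft n j)
      topple-j rewrite topple≡ c A j | ∉⇒lookup≡false j∉A = ℤ.+-identityʳ _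

    ∈⇔degree≤ : ∀ j →
      j ∈ A ⇔ degree (isLeft n j) ℤ.≤ c j ℤ.+ neighboursIn A (isLeft n j)
    ∈⇔degree≤ j = mk⇔ ∈⇒degree≤ fires
      where
      fires : degree (isLeft n j) ℤ.≤ c j ℤ.+ neighboursIn A (isLeft n j) → j ∈ A
      fires degree≤ with j ∈? A
      ... | yes j∈A = j∈A
      ... | no  j∉A = contradiction degree≤ (ℤ.<⇒≱ (∉⇒<degree j∉A))

    ∉∈⇒< : ∀ {i j} → isLeft n i ≡ isLeft n j → i ∉ A → j ∈ A → c i < c j
    ∉∈⇒< {i} {j} same-side i∉A j∈A = ℤ.≰⇒> λ cj≤ci → ℤ.<-irrefl refl
      (ℤ.<-≤-trans (∉⇒<degree i∉A) (ℤ.≤-trans degree≤ (ℤ.+-monoˡ-≤ _ cj≤ci)))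
      where
      degree≤ : degree (isLeft n i) ℤ.≤ c j ℤ.+ neighboursIn A (isLeft n i)
      degree≤ rewrite same-side = ∈⇒degree≤ j∈A

    ∈⇒neighbour∈ : Stable n m c → ∀ {j} → j ∈ A →
      ∃ λ i → i ∈ A × isLeft n i ≡ not (isLeft n j)
    ∈⇒neighbour∈ stable {j} j∈A = Prod.map₂ split (0<sumFin-indicator⇒∃ N _ neighbours>0)
      where
      split : ∀ {i} → T (lookup A i ∧ (isLeft n i xor isLeft n j)) →
        i ∈ A × isLeft n i ≡ not (isLeft n j)
      split {i} T[i] with A[i] , opposite ← to T-∧ T[i] =
        lookup⇒[]= i A (to T-≡ A[i]) , T-xor _ _ opposite
      neighbours>0 : 0ℤ < neighboursIn A (isLeft n j)
      neighbours>0 = ℤ.≰⇒> λ neighbours≤0 → ℤ.<-irrefl refl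
        (ℤ.<-≤-trans (stable⇒<degree stable j)
          (ℤ.≤-trans (∈⇒degree≤ j∈A)
            (ℤ.≤-trans (ℤ.+-monoʳ-≤ (c j) neighbours≤0) (ℤ.≤-reflexive (ℤ.+-identityʳ (c j))))))

    ∈-upward-closed : Sorted n m c → ∀ {i j} → i ∈ A → toℕ i ≤ toℕ j →
      toℕ j ℕ.< n ⊎ n ≤ toℕ i → j ∈ A
    ∈-upward-closed sorted {i} {j} i∈A i≤j side = from (∈⇔degree≤ j)
      (subst (λ s → degree s ℤ.≤ c j ℤ.+ neighboursIn A s) (same-side i≤j side)
        (ℤ.≤-trans (∈⇒degree≤ i∈A) (ℤ.+-monoˡ-≤ _ (sorted-monotone sorted i≤j side))))

    both-sides∈ : Stable n m c → Nonempty A →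
      (∃ λ i → i ∈ A × toℕ i ℕ.< n) × (∃ λ j → j ∈ A × n ≤ toℕ j)
    both-sides∈ stable (x , x∈A) = sides (isLeft n x) refl (∈⇒neighbour∈ stable x∈A)
      where
      sides : ∀ b → isLeft n x ≡ b → (∃ λ y → y ∈ A × isLeft n y ≡ not (isLeft n x)) →
        (∃ λ i → i ∈ A × toℕ i ℕ.< n) × (∃ λ j → j ∈ A × n ≤ toℕ j)
      sides true  x-side (y , y∈A , y-side) =
        (x , x∈A , isLeft≡true⇒< n x-side) ,
        (y , y∈A , isLeft≡false⇒≥ n (trans y-side (cong not x-side)))
      sides false x-side (y , y∈A , y-side) =
        (y , y∈A , isLeft≡true⇒< n (trans y-side (cong not x-side))) ,
        (x , x∈A , isLeft≡false⇒≥ n x-side)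

    left-threshold : Sorted n m c → ∃ λ s → ∀ j → toℕ j ℕ.< n → j ∈ A ⇔ s ≤ toℕ j
    -- Adding every right-hand vertex makes the left part upward closed on all of Fin N.
    left-threshold sorted =
      Prod.map₂ restrict (upward-closed⇒threshold (λ j → (j ∈? A) ⊎-dec (n ℕ.≤? toℕ j)) up)
      where
      restrict : ∀ {s} → (∀ j → (j ∈ A ⊎ n ≤ toℕ j) ⇔ s ≤ toℕ j) →
        ∀ j → toℕ j ℕ.< n → j ∈ A ⇔ s ≤ toℕ j
      restrict ⇔s≤ j j<n = mk⇔ (to (⇔s≤ j) ∘ inj₁)
        ([ id , (λ n≤j → contradiction j<n (ℕ.≤⇒≯ n≤j)) ] ∘ from (⇔s≤ j))
      up : ∀ {i j} → toℕ i ≤ toℕ j → i ∈ A ⊎ n ≤ toℕ i → j ∈ A ⊎ n ≤ toℕ j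
      up {j = j} i≤j (inj₁ i∈A) with toℕ j ℕ.<? n
      ... | yes j<n = inj₁ (∈-upward-closed sorted i∈A i≤j (inj₁ j<n))
      ... | no  j≮n = inj₂ (ℕ.≮⇒≥ j≮n)
      up i≤j (inj₂ n≤i) = inj₂ (ℕ.≤-trans n≤i i≤j)

    right-threshold : Sorted n m c → ∃ λ t → ∀ j → (j ∈ A × n ≤ toℕ j) ⇔ t ≤ toℕ j
    right-threshold sorted = upward-closed⇒threshold (λ j → (j ∈? A) ×-dec (n ℕ.≤? toℕ j)) up
      where
      up : ∀ {i j} → toℕ i ≤ toℕ j → i ∈ A × n ≤ toℕ i → j ∈ A × n ≤ toℕ j
      up i≤j (i∈A , n≤i) = ∈-upward-closed sorted i∈A i≤j (inj₂ n≤i) , ℕ.≤-trans n≤i i≤j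

    final-segments : Stable n m c → Sorted n m c → Nonempty A → FinalSegments A
    final-segments stable sorted nonempty =
      let (x , x∈A , x<n) , (y , y∈A , n≤y) = both-sides∈ stable nonempty
          s , ⇔s≤ = left-threshold sorted
          t , ⇔t≤ = right-threshold sorted
          t<N = ℕ.≤-<-trans (to (⇔t≤ y) (y∈A , n≤y)) (toℕ<n y)
          t′ = fromℕ< t<N
      in record
        { s = s
        ; t = t
        ; s<n = ℕ.≤-<-trans (to (⇔s≤ x x<n) x∈A) x<n
        ; n≤t = subst (n ≤_) (toℕ-fromℕ< t<N)
                  (proj₂ (from (⇔t≤ t′) (ℕ.≤-reflexive (sym (toℕ-fromℕ< t<N)))))
        ; t<N = t<N
        ; ∈A⇔ = λ j → mk⇔
            (λ j∈A → map (λ j<n → to (⇔s≤ j j<n) j∈A , j<n) (λ n≤j → to (⇔t≤ j) (j∈A , n≤j))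
                         (ℕ.<-≤-connex (toℕ j) n))
            [ (λ (s≤j , j<n) → from (⇔s≤ j j<n) s≤j) , proj₁ ∘ from (⇔t≤ j) ]
        }

    module _ (segments : FinalSegments A) where
      open FinalSegments segments

      left-jump : ∀ {i j} → suc (toℕ i) ≡ s → toℕ j ≡ s → c i < c j
      left-jump {i} {j} i+1≡s j≡s =
        ∉∈⇒< (trans (isLeft-< n i<n) (sym (isLeft-< n j<n))) i∉A j∈A
        where
        i<s : toℕ i ℕ.< s
        i<s = ℕ.≤-reflexive i+1≡s
        i<n : toℕ i ℕ.< n
        i<n = ℕ.<-trans i<s s<n
        j<n : toℕ j ℕ.< n
        j<n = subst (ℕ._< n) (sym j≡s) s<n
        i∉A : i ∉ A
        i∉A = [ (λ (s≤i , _) → ℕ.<⇒≱ i<s s≤i) , ℕ.<⇒≱ (ℕ.<-≤-trans i<n n≤t) ] ∘ to (∈A⇔ i)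
        j∈A : j ∈ A
        j∈A = from (∈A⇔ j) (inj₁ (ℕ.≤-reflexive (sym j≡s) , j<n))

      right-jump : ∀ {i j} → n ℕ.< t → suc (toℕ i) ≡ t → toℕ j ≡ t → c i < c j
      right-jump {i} {j} n<t i+1≡t j≡t =
        ∉∈⇒< (trans (isLeft-≥ n n≤i) (sym (isLeft-≥ n n≤j))) i∉A j∈A
        where
        n≤i : n ≤ toℕ i
        n≤i = ℕ.s≤s⁻¹ (subst (suc n ≤_) (sym i+1≡t) n<t)
        i<t : toℕ i ℕ.< t
        i<t = ℕ.≤-reflexive i+1≡t
        n≤j : n ≤ toℕ j
        n≤j = subst (n ≤_) (sym j≡t) n≤t
        i∉A : i ∉ A
        i∉A = [ (λ (_ , i<n) → ℕ.<⇒≱ i<n n≤i) , ℕ.<⇒≱ i<t ] ∘ to (∈A⇔ i)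
        j∈A : j ∈ A
        j∈A = from (∈A⇔ j) (inj₂ (ℕ.≤-reflexive (sym j≡t)))

proposition4p2 : (n m : ℕ) → 1 ≤ n → 1 ≤ m → (c : Config n m) →
    Stable n m c → Sorted n m c → (A : Subset (n + m ∸ 1)) →
    MinimalAdmissible n m c A →
    Σ ℕ λ k → Σ ℕ λ l → (k + 1 ≤ n) × (l + 2 ≤ m) ×
      (∀ (j : Fin (n + m ∸ 1)) →
        ((j ∈ A) → ((n ∸ k ≤ suc (toℕ j)) × (suc (toℕ j) ≤ n))
                   ⊎ ((m + n ∸ 1 ∸ l ≤ suc (toℕ j)) × (suc (toℕ j) ≤ n + m ∸ 1)))
        × ((((n ∸ k ≤ suc (toℕ j)) × (suc (toℕ j) ≤ n))
                   ⊎ ((m + n ∸ 1 ∸ l ≤ suc (toℕ j)) × (suc (toℕ j) ≤ n + m ∸ 1))) → j ∈ A))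
      × (suc k ≤ n ∸ 1 → ∀ (i j : Fin (n + m ∸ 1)) →
           suc (toℕ i) ≡ n ∸ k ∸ 1 → suc (toℕ j) ≡ n ∸ k → c i < c j)
      × (suc l ≤ m ∸ 2 → ∀ (i j : Fin (n + m ∸ 1)) →
           suc (toℕ i) ≡ m + n ∸ 2 ∸ l → suc (toℕ j) ≡ m + n ∸ 1 ∸ l → c i < c j)
proposition4p2 n m _ _ c stable sorted A ((nonempty , stable-after) , _) =
  k , l , m∸[1+n]+1≤m s<n , [n+m∸1]∸[1+t]+2≤m n≤t t<N ,
  (λ j → to (membership j) , from (membership j)) ,
  (λ _ i j i+1≡ j+1≡ → left-jump n m stable-after segments
    (trans i+1≡ (cong ℕ.pred n∸k≡1+s)) (ℕ.suc-injective (trans j+1≡ n∸k≡1+s))) ,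
  (λ 1+l≤m∸2 i j i+1≡ j+1≡ → right-jump n m stable-after segments
    (suc[[n+m∸1]∸[1+t]]≤m∸2⇒n<t n≤t 1+l≤m∸2)
    (trans i+1≡ (trans (m∸2∸n≡pred[m∸1∸n] (m + n) l) (cong ℕ.pred m+n∸1∸l≡1+t)))
    (ℕ.suc-injective (trans j+1≡ m+n∸1∸l≡1+t)))
  where
  segments : FinalSegments n m A
  segments = final-segments n m stable-after stable sorted nonempty
  open FinalSegments segments
  k l : ℕ
  k = n ∸ suc s
  l = n + m ∸ 1 ∸ suc t
  n∸k≡1+s : n ∸ k ≡ suc s
  n∸k≡1+s = ℕ.m∸[m∸n]≡n s<n
  m+n∸1∸l≡1+t : m + n ∸ 1 ∸ l ≡ suc t
  m+n∸1∸l≡1+t = trans (cong (λ x → x ∸ 1 ∸ l) (ℕ.+-comm m n)) (ℕ.m∸[m∸n]≡n t<N)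
  membership : ∀ j → j ∈ A ⇔ ((n ∸ k ≤ suc (toℕ j) × suc (toℕ j) ≤ n)
                               ⊎ (m + n ∸ 1 ∸ l ≤ suc (toℕ j) × suc (toℕ j) ≤ n + m ∸ 1))
  membership = ∈A⇔-1-based n m segments n∸k≡1+s m+n∸1∸l≡1+t
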